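{- Let $\Sigma$ be a simplicial complex whose vertex set is endowed with a total order, and for each $k \geq 0$ let $\Sigma_{k+1}$ denote the set of $(k+1)$-simplices of $\Sigma$. Order the $k$-simplices of $\Sigma$ lexicographically by their increasingly ordered vertex lists, and order pairs $(\sigma_0 < \sigma_1)$ of distinct $k$-simplices (written with the smaller first) lexicographically: $(\sigma_0<\sigma_1) < (\tau_0<\tau_1)$ iff $\sigma_0<\tau_0$, or $\sigma_0=\tau_0$ and $\sigma_1<\tau_1$. Let $P_k$ be the set of pairs $(\sigma_0 < \sigma_1)$ of distinct $k$-simplices of $\Sigma$ such that (a) $\tau := \sigma_0 \cup \sigma_1 \in \Sigma_{k+1}$, and (b) $(\sigma_0 < \sigma_1)$ is minimal among all pairs of $k$-faces of the common $(k+1)$-dimensional coface $\tau$; equivalently, $\sigma_0$ and $\sigma_1$ are the smallest and second-smallest $k$-faces of $\tau$ in the lexicographic order. Then: (1) For every $k > 1$, there is a bijection between $P_k$ and $\Sigma_{k+1}$. (2) If $k > 1$, then for every pair $(\sigma_0 < \sigma_1) \in P_k$, the simplices $\sigma_0$ and $\sigma_1$ have a common $(k-1)$-face $\rho \in \Sigma$, and $\rho$ is the minimal (in the lexicographic order) $(k-1)$-face of $\tau = \sigma_0\cup\sigma_1$, and also the minimal $(k-1)$-face of both $\sigma_0$ and $\sigma_1$.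
   Context: A $j$-simplex is a simplex with $j+1$ vertices; a $j$-face of a simplex is a subset with $j+1$ vertices. -}

module Defs where

open import Level using (0ℓ)
open import Data.Nat using (ℕ; zero; suc; _+_)
open import Data.List using (List; []; length)
open import Data.List.Membership.Propositional using (_∈_)
open import Data.List.Relation.Unary.Linked using (Linked)
open import Data.List.Relation.Binary.Lex.Strict using (Lex-<)
open import Data.Product using (Σ; _×_; _,_; proj₁; ∃)
open import Data.Sum using (_⊎_)
open import Relation.Nullary using (¬_)
open import Relation.Binary using (Rel; Setoid)
open import Relation.Binary.PropositionalEquality using (_≡_; _≢_; setoid)
import Relation.Binary.Construct.On as On

module _ {V : Set} (_≺_ : Rel V 0ℓ) where

  -- a finite vertex set is represented by the list of its vertices in
  -- strictly increasing order (w.r.t. the total order _≺_ on vertices)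
  Increasing : List V → Set
  Increasing = Linked _≺_

  _⊆ₛ_ : List V → List V → Set
  s ⊆ₛ t = ∀ x → x ∈ s → x ∈ t

  record SimplicialComplex : Set₁ where
    field
      simplex    : List V → Set
      increasing : ∀ s → simplex s → Increasing s
      nonempty   : ∀ s → simplex s → s ≢ []
      closed     : ∀ s t → simplex s → Increasing t → t ≢ [] → t ⊆ₛ s → simplex t

  _<ₗ_ : List V → List V → Set
  _<ₗ_ = Lex-< _≡_ _≺_

  _<ₚ_ : List V × List V → List V × List V → Set
  (a₀ , a₁) <ₚ (b₀ , b₁) = (a₀ <ₗ b₀) ⊎ (a₀ ≡ b₀ × a₁ <ₗ b₁)

  Face : ℕ → List V → List V → Set
  Face j σ τ = Increasing σ × σ ⊆ₛ τ × length σ ≡ suc j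

  IsUnion : List V → List V → List V → Set
  IsUnion σ₀ σ₁ τ = ∀ x → (x ∈ τ → x ∈ σ₀ ⊎ x ∈ σ₁) × (x ∈ σ₀ ⊎ x ∈ σ₁ → x ∈ τ)

  IsMinFace : ℕ → List V → List V → Set
  IsMinFace j ρ τ = Face j ρ τ × (∀ ρ' → Face j ρ' τ → ¬ (ρ' <ₗ ρ))

  module _ (K : SimplicialComplex) where
    open SimplicialComplex K

    IsSimplexOfDim : ℕ → List V → Set
    IsSimplexOfDim j s = simplex s × length s ≡ suc j

    SimplicesSetoid : ℕ → Setoid 0ℓ 0ℓ
    SimplicesSetoid j = On.setoid {B = Σ (List V) (IsSimplexOfDim j)} (setoid (List V)) proj₁

    InPWith : ℕ → List V → List V → List V → Set
    InPWith k σ₀ σ₁ τ =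
      IsSimplexOfDim k σ₀ × IsSimplexOfDim k σ₁ × σ₀ <ₗ σ₁
      × IsUnion σ₀ σ₁ τ × IsSimplexOfDim (suc k) τ
      × (∀ ρ₀ ρ₁ → Face k ρ₀ τ → Face k ρ₁ τ → ρ₀ <ₗ ρ₁ → ¬ ((ρ₀ , ρ₁) <ₚ (σ₀ , σ₁)))

    InP : ℕ → List V × List V → Set
    InP k (σ₀ , σ₁) = ∃ λ τ → InPWith k σ₀ σ₁ τ

    PSetoid : ℕ → Setoid 0ℓ 0ℓ
    PSetoid k = On.setoid {B = Σ (List V × List V) (InP k)} (setoid (List V × List V)) proj₁

module Submission where

-- Write τ = v₀ < ⋯ < v_{k+1}; its k-faces are the lists τ ∖ {vᵢ}. Any subset of τ is
-- lexicographically at least the prefix of τ of the same size, since at the first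
-- position where they differ the prefix has the smaller vertex. Hence the smallest k-face
-- is τ ∖ {v_{k+1}} = take (k+1) τ, and the same argument one vertex later shows that the
-- second smallest is τ ∖ {v_k} = dropPenultimate τ. So a pair in P_k is this pair for
-- its union τ, which gives P_k ≅ Σ_{k+1}; both faces begin with v₀ < ⋯ < v_{k-1}, the
-- smallest (k-1)-face of τ and of each of them.

open import Defs
open import Level using (0ℓ)
open import Data.Nat using (ℕ; zero; suc; pred; _<_; _≤_; _⊓_)
open import Data.Nat.Properties using (suc-injective; n≤1+n; m≤n⇒m⊓n≡m; ≤-trans)
open import Data.List using (List; []; _∷_; length; take)
open import Data.List.Properties using (length-take; take-take)
import Data.List.Relation.Unary.All as All
open import Data.List.Relation.Unary.AllPairs using (AllPairs; []; _∷_)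
open import Data.List.Relation.Unary.Any as Any using (here; there)
open import Data.List.Relation.Unary.Linked using (_∷_; tail)
open import Data.List.Relation.Unary.Linked.Properties using (Linked⇒AllPairs; AllPairs⇒Linked)
open import Data.List.Relation.Binary.Lex.Strict using (this; next; <-isStrictTotalOrder)
open import Data.List.Relation.Binary.Pointwise using (≡⇒Pointwise-≡)
import Data.List.Relation.Binary.Sublist.Propositional as Sublist
open import Data.List.Relation.Binary.Sublist.Propositional using (_∷ʳ_; ⊆-refl)
open import Data.List.Relation.Binary.Sublist.Propositional.Properties using (All-resp-⊆; take-⊆)
open import Data.Product using (_×_; ∃; Σ; _,_; proj₁; proj₂)
open import Data.Sum using (_⊎_; inj₁; inj₂; [_,_]′)
import Data.Sum as Sum
open import Data.Empty using (⊥-elim)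
open import Relation.Nullary using (¬_)
open import Relation.Binary using (Rel; IsStrictTotalOrder)
open import Relation.Binary.PropositionalEquality using (_≡_; _≢_; refl; sym; trans; cong; cong₂; subst; module ≡-Reasoning)
open import Function.Bundles using (Bijection)
open import Data.List.Membership.Propositional using (_∈_)

m≡1+n⇒n≤m : ∀ {m n} → m ≡ suc n → n ≤ m
m≡1+n⇒n≤m {n = n} refl = n≤1+n n

length≡1+n⇒≢[] : ∀ {A : Set} {xs : List A} {n} → length xs ≡ suc n → xs ≢ []
length≡1+n⇒≢[] {xs = _ ∷ _} _ ()

dropPenultimate : {A : Set} → List A → List A
dropPenultimate [] = []
dropPenultimate (x ∷ []) = x ∷ []
dropPenultimate (x ∷ y ∷ []) = y ∷ []
dropPenultimate (x ∷ y ∷ z ∷ zs) = x ∷ dropPenultimate (y ∷ z ∷ zs)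

module _ {A : Set} where

  AllPairs-resp-⊆ : ∀ {R : Rel A 0ℓ} {xs ys} → xs Sublist.⊆ ys → AllPairs R ys → AllPairs R xs
  AllPairs-resp-⊆ Sublist.[] [] = []
  AllPairs-resp-⊆ (_ ∷ʳ p) (_ ∷ rs) = AllPairs-resp-⊆ p rs
  AllPairs-resp-⊆ (refl Sublist.∷ p) (r ∷ rs) = All-resp-⊆ p r ∷ AllPairs-resp-⊆ p rs

  length-take-≤ : ∀ {n} (xs : List A) → n ≤ length xs → length (take n xs) ≡ n
  length-take-≤ {n} xs n≤ = trans (length-take n xs) (m≤n⇒m⊓n≡m n≤)

  dropPenultimate-⊆ : (xs : List A) → dropPenultimate xs Sublist.⊆ xs
  dropPenultimate-⊆ [] = Sublist.[]
  dropPenultimate-⊆ (x ∷ []) = ⊆-refl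
  dropPenultimate-⊆ (x ∷ y ∷ []) = x ∷ʳ ⊆-refl
  dropPenultimate-⊆ (x ∷ y ∷ z ∷ zs) = refl Sublist.∷ dropPenultimate-⊆ (y ∷ z ∷ zs)

  length-dropPenultimate : ∀ k (xs : List A) → length xs ≡ suc (suc k) → length (dropPenultimate xs) ≡ suc k
  length-dropPenultimate k (x ∷ y ∷ []) refl = refl
  length-dropPenultimate (suc k) (x ∷ y ∷ z ∷ zs) len =
    cong suc (length-dropPenultimate k (y ∷ z ∷ zs) (suc-injective len))

  take-dropPenultimate : ∀ k (xs : List A) → length xs ≡ suc (suc k) → take k (dropPenultimate xs) ≡ take k xs
  take-dropPenultimate zero xs _ = refl
  take-dropPenultimate (suc k) (x ∷ y ∷ z ∷ zs) len =
    cong (x ∷_) (take-dropPenultimate k (y ∷ z ∷ zs) (suc-injective len))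

  ∈-take⊎dropPenultimate : ∀ k (xs : List A) → length xs ≡ suc (suc k) →
    ∀ {z} → z ∈ xs → z ∈ take (suc k) xs ⊎ z ∈ dropPenultimate xs
  ∈-take⊎dropPenultimate k (x ∷ y ∷ []) refl (here z≡x) = inj₁ (here z≡x)
  ∈-take⊎dropPenultimate k (x ∷ y ∷ []) refl (there z∈ys) = inj₂ z∈ys
  ∈-take⊎dropPenultimate (suc k) (x ∷ y ∷ z ∷ zs) len (here w≡x) = inj₁ (here w≡x)
  ∈-take⊎dropPenultimate (suc k) (x ∷ y ∷ z ∷ zs) len (there w∈ys) =
    Sum.map there there (∈-take⊎dropPenultimate k (y ∷ z ∷ zs) (suc-injective len) w∈ys)

module _ {V : Set} {_≺_ : Rel V 0ℓ} (sto : IsStrictTotalOrder _≡_ _≺_) where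
  open IsStrictTotalOrder sto using (irrefl) renaming (trans to ≺-trans)

  Inc : List V → Set
  Inc = Increasing _≺_

  _⊆_ : List V → List V → Set
  _⊆_ = _⊆ₛ_ _≺_

  _<L_ : List V → List V → Set
  _<L_ = _<ₗ_ _≺_

  _≤L_ : List V → List V → Set
  xs ≤L ys = xs ≡ ys ⊎ xs <L ys

  private
    module LexOrder = IsStrictTotalOrder (<-isStrictTotalOrder sto)

  <L-irrefl : ∀ {xs} → ¬ (xs <L xs)
  <L-irrefl = LexOrder.irrefl (≡⇒Pointwise-≡ refl)

  ≤L⇒≯L : ∀ {xs ys} → xs ≤L ys → ¬ (ys <L xs)
  ≤L⇒≯L (inj₁ refl) = <L-irrefl
  ≤L⇒≯L (inj₂ xs<ys) = LexOrder.asym xs<ys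

  ∷-≤L : ∀ {x y xs ys} → x ≡ y → xs ≤L ys → (x ∷ xs) ≤L (y ∷ ys)
  ∷-≤L x≡y = Sum.map (cong₂ _∷_ x≡y) (next x≡y)

  Inc-resp-⊆ : ∀ {xs ys} → xs Sublist.⊆ ys → Inc ys → Inc xs
  Inc-resp-⊆ p i = AllPairs⇒Linked (AllPairs-resp-⊆ p (Linked⇒AllPairs ≺-trans i))

  head-≺ : ∀ {x y xs} → Inc (x ∷ xs) → y ∈ xs → x ≺ y
  head-≺ i with Linked⇒AllPairs ≺-trans i
  ... | x≺xs ∷ _ = All.lookup x≺xs

  ⊆-tail : ∀ {x y xs ys} → x ≡ y → Inc (x ∷ xs) → (x ∷ xs) ⊆ (y ∷ ys) → xs ⊆ ys
  ⊆-tail refl i s z z∈xs with s z (there z∈xs)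
  ... | here refl = ⊥-elim (irrefl refl (head-≺ i z∈xs))
  ... | there z∈ys = z∈ys

  Inc-⊆-antisym : ∀ {xs ys} → Inc xs → Inc ys → xs ⊆ ys → ys ⊆ xs → xs ≡ ys
  Inc-⊆-antisym {[]} {[]} _ _ _ _ = refl
  Inc-⊆-antisym {[]} {y ∷ _} _ _ _ ys⊆xs with ys⊆xs y (here refl)
  ... | ()
  Inc-⊆-antisym {x ∷ _} {[]} _ _ xs⊆ys _ with xs⊆ys x (here refl)
  ... | ()
  Inc-⊆-antisym {x ∷ xs} {y ∷ ys} ixs iys xs⊆ys ys⊆xs = cong₂ _∷_ x≡y
    (Inc-⊆-antisym (tail ixs) (tail iys) (⊆-tail x≡y ixs xs⊆ys) (⊆-tail (sym x≡y) iys ys⊆xs))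
    where
    x≡y : x ≡ y
    x≡y with xs⊆ys x (here refl) | ys⊆xs y (here refl)
    ... | here x≡y | _ = x≡y
    ... | there _ | here y≡x = sym y≡x
    ... | there x∈ys | there y∈xs = ⊥-elim (irrefl refl (≺-trans (head-≺ ixs y∈xs) (head-≺ iys x∈ys)))

  Sublist⇒⊆ : ∀ {xs ys} → xs Sublist.⊆ ys → xs ⊆ ys
  Sublist⇒⊆ p _ = Sublist.lookup p

  Face-resp-Sublist : ∀ {j xs ys} → xs Sublist.⊆ ys → Inc ys → length xs ≡ suc j → Face _≺_ j xs ys
  Face-resp-Sublist p i len = Inc-resp-⊆ p i , Sublist⇒⊆ p , len

  take-length-≤L : ∀ {ρ τ} → Inc τ → Inc ρ → ρ ⊆ τ → take (length ρ) τ ≤L ρ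
  take-length-≤L {[]} _ _ _ = inj₁ refl
  take-length-≤L {r ∷ _} {[]} _ _ ρ⊆τ with ρ⊆τ r (here refl)
  ... | ()
  take-length-≤L {r ∷ _} {t ∷ _} iτ iρ ρ⊆τ with ρ⊆τ r (here refl)
  ... | here refl = ∷-≤L refl (take-length-≤L (tail iτ) (tail iρ) (⊆-tail refl iρ ρ⊆τ))
  ... | there r∈τ = inj₂ (this (head-≺ iτ r∈τ))

  take-≤L-face : ∀ {j ρ τ} → Inc τ → Face _≺_ j ρ τ → take (suc j) τ ≤L ρ
  take-≤L-face {ρ = ρ} {τ} iτ (iρ , ρ⊆τ , len) =
    subst (λ n → take n τ ≤L ρ) len (take-length-≤L iτ iρ ρ⊆τ)

  take-IsMinFace : ∀ {j τ} → Inc τ → suc j ≤ length τ → IsMinFace _≺_ j (take (suc j) τ) τ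
  take-IsMinFace {j} {τ} iτ j<τ =
    Face-resp-Sublist (take-⊆ (suc j) τ) iτ (length-take-≤ τ j<τ) ,
    λ ρ ρ-face → ≤L⇒≯L (take-≤L-face iτ ρ-face)

  IsMinFace-take : ∀ {j ρ σ} → Inc σ → suc j ≤ length σ → take (suc j) σ ≡ ρ → IsMinFace _≺_ j ρ σ
  IsMinFace-take iσ j<σ refl = take-IsMinFace iσ j<σ

  take<LdropPenultimate : ∀ k τ → Inc τ → length τ ≡ suc (suc k) → take (suc k) τ <L dropPenultimate τ
  take<LdropPenultimate k (x ∷ y ∷ []) (x≺y ∷ _) refl = this x≺y
  take<LdropPenultimate (suc k) (x ∷ y ∷ z ∷ zs) iτ len =
    next refl (take<LdropPenultimate k (y ∷ z ∷ zs) (tail iτ) (suc-injective len))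

  dropPenultimate-≤L : ∀ {ρ τ} → Inc τ → Inc ρ → ρ ⊆ τ → length τ ≡ suc (length ρ) →
    ρ ≢ take (length ρ) τ → dropPenultimate τ ≤L ρ
  dropPenultimate-≤L {[]} _ _ _ _ ρ≢ = ⊥-elim (ρ≢ refl)
  dropPenultimate-≤L {r ∷ []} {t ∷ u ∷ []} _ _ ρ⊆τ _ ρ≢ with ρ⊆τ r (here refl)
  ... | here refl = ⊥-elim (ρ≢ refl)
  ... | there (here refl) = inj₁ refl
  dropPenultimate-≤L {r ∷ ρ@(_ ∷ _)} {t ∷ τ@(_ ∷ _ ∷ _)} iτ iρ ρ⊆τ len ρ≢ =
    [ (λ r≡t → ∷-≤L (sym r≡t) (dropPenultimate-≤L (tail iτ) (tail iρ) (⊆-tail r≡t iρ ρ⊆τ)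
                                  (suc-injective len) (λ ρ≡ → ρ≢ (cong₂ _∷_ r≡t ρ≡))))
    , (λ r∈τ → inj₂ (this (head-≺ iτ r∈τ))) ]′ (Any.toSum (ρ⊆τ r (here refl)))

  dropPenultimate-≤L-face : ∀ {k ρ τ} → Inc τ → length τ ≡ suc (suc k) → Face _≺_ k ρ τ →
    take (suc k) τ <L ρ → dropPenultimate τ ≤L ρ
  dropPenultimate-≤L-face {k} {ρ} {τ} iτ lτ (iρ , ρ⊆τ , lρ) take<ρ =
    dropPenultimate-≤L iτ iρ ρ⊆τ (trans lτ (cong suc (sym lρ))) ρ≢take
    where
    ρ≢take : ρ ≢ take (length ρ) τ
    ρ≢take ρ≡ = <L-irrefl (subst (take (suc k) τ <L_) (trans ρ≡ (cong (λ n → take n τ) lρ)) take<ρ)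

  take-Face : ∀ {k τ} → Inc τ → length τ ≡ suc (suc k) → Face _≺_ k (take (suc k) τ) τ
  take-Face iτ lτ = proj₁ (take-IsMinFace iτ (m≡1+n⇒n≤m lτ))

  dropPenultimate-Face : ∀ {k τ} → Inc τ → length τ ≡ suc (suc k) → Face _≺_ k (dropPenultimate τ) τ
  dropPenultimate-Face {k} {τ} iτ lτ =
    Face-resp-Sublist (dropPenultimate-⊆ τ) iτ (length-dropPenultimate k τ lτ)

  MinimalFacePair : ℕ → List V → List V → List V → Set
  MinimalFacePair k τ σ₀ σ₁ = ∀ ρ₀ ρ₁ → Face _≺_ k ρ₀ τ → Face _≺_ k ρ₁ τ → ρ₀ <L ρ₁ →
    ¬ (_<ₚ_ _≺_ (ρ₀ , ρ₁) (σ₀ , σ₁))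

  take-dropPenultimate-minimal : ∀ {k τ} → Inc τ → length τ ≡ suc (suc k) →
    MinimalFacePair k τ (take (suc k) τ) (dropPenultimate τ)
  take-dropPenultimate-minimal iτ lτ ρ₀ ρ₁ ρ₀-face _ _ (inj₁ ρ₀<take) =
    ≤L⇒≯L (take-≤L-face iτ ρ₀-face) ρ₀<take
  take-dropPenultimate-minimal iτ lτ ρ₀ ρ₁ _ ρ₁-face ρ₀<ρ₁ (inj₂ (refl , ρ₁<dp)) =
    ≤L⇒≯L (dropPenultimate-≤L-face iτ lτ ρ₁-face ρ₀<ρ₁) ρ₁<dp

  minimalFacePair-unique : ∀ {k τ σ₀ σ₁} → Inc τ → length τ ≡ suc (suc k) →
    Face _≺_ k σ₀ τ → Face _≺_ k σ₁ τ → σ₀ <L σ₁ → MinimalFacePair k τ σ₀ σ₁ →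
    σ₀ ≡ take (suc k) τ × σ₁ ≡ dropPenultimate τ
  minimalFacePair-unique {k} {τ} {σ₀} {σ₁} iτ lτ σ₀-face σ₁-face σ₀<σ₁ minimal = σ₀≡ , σ₁≡
    where
    no-smaller : ¬ (_<ₚ_ _≺_ (take (suc k) τ , dropPenultimate τ) (σ₀ , σ₁))
    no-smaller = minimal _ _ (take-Face iτ lτ) (dropPenultimate-Face iτ lτ) (take<LdropPenultimate k τ iτ lτ)

    σ₀≡ : σ₀ ≡ take (suc k) τ
    σ₀≡ with take-≤L-face iτ σ₀-face
    ... | inj₁ take≡σ₀ = sym take≡σ₀
    ... | inj₂ take<σ₀ = ⊥-elim (no-smaller (inj₁ take<σ₀))

    σ₁≡ : σ₁ ≡ dropPenultimate τ
    σ₁≡ with dropPenultimate-≤L-face iτ lτ σ₁-face (subst (_<L σ₁) σ₀≡ σ₀<σ₁)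
    ... | inj₁ dp≡σ₁ = sym dp≡σ₁
    ... | inj₂ dp<σ₁ = ⊥-elim (no-smaller (inj₂ (sym σ₀≡ , dp<σ₁)))

  IsUnion-unique : ∀ {σ₀ σ₁ τ τ′} → Inc τ → Inc τ′ → IsUnion _≺_ σ₀ σ₁ τ → IsUnion _≺_ σ₀ σ₁ τ′ → τ ≡ τ′
  IsUnion-unique iτ iτ′ τ-union τ′-union = Inc-⊆-antisym iτ iτ′
    (λ z z∈τ → proj₂ (τ′-union z) (proj₁ (τ-union z) z∈τ))
    (λ z z∈τ′ → proj₂ (τ-union z) (proj₁ (τ′-union z) z∈τ′))

  module _ (K : SimplicialComplex _≺_) where
    open SimplicialComplex K

    face-simplex : ∀ {j ρ τ} → simplex τ → Face _≺_ j ρ τ → IsSimplexOfDim _≺_ K j ρ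
    face-simplex {ρ = ρ} {τ} sτ (iρ , ρ⊆τ , lρ) = closed τ ρ sτ iρ (length≡1+n⇒≢[] lρ) ρ⊆τ , lρ

    InPWith⇒canonical : ∀ {k σ₀ σ₁ τ} → InPWith _≺_ K k σ₀ σ₁ τ →
      σ₀ ≡ take (suc k) τ × σ₁ ≡ dropPenultimate τ
    InPWith⇒canonical {σ₀ = σ₀} {σ₁} {τ} ((sσ₀ , lσ₀) , (sσ₁ , lσ₁) , σ₀<σ₁ , τ-union , (sτ , lτ) , minimal) =
      minimalFacePair-unique (increasing τ sτ) lτ
        (increasing σ₀ sσ₀ , (λ z z∈σ₀ → proj₂ (τ-union z) (inj₁ z∈σ₀)) , lσ₀)
        (increasing σ₁ sσ₁ , (λ z z∈σ₁ → proj₂ (τ-union z) (inj₂ z∈σ₁)) , lσ₁)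
        σ₀<σ₁ minimal

    canonical-InPWith : ∀ {k τ} → IsSimplexOfDim _≺_ K (suc k) τ →
      InPWith _≺_ K k (take (suc k) τ) (dropPenultimate τ) τ
    canonical-InPWith {k} {τ} (sτ , lτ) =
      face-simplex sτ (take-Face iτ lτ) ,
      face-simplex sτ (dropPenultimate-Face iτ lτ) ,
      take<LdropPenultimate k τ iτ lτ ,
      (λ z → ∈-take⊎dropPenultimate k τ lτ ,
             [ Sublist⇒⊆ (take-⊆ (suc k) τ) z , Sublist⇒⊆ (dropPenultimate-⊆ τ) z ]′) ,
      (sτ , lτ) ,
      take-dropPenultimate-minimal iτ lτ
      where
      iτ : Inc τ
      iτ = increasing τ sτ

    P↔simplices : ∀ k → Bijection (PSetoid _≺_ K k) (SimplicesSetoid _≺_ K (suc k))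
    P↔simplices k = record
      { to = union-simplex
      ; cong = λ {p} {q} → union-cong p q
      ; bijective = (λ {p} {q} → union-injective p q) , surjective
      }
      where
      P : Set
      P = Σ (List V × List V) (InP _≺_ K k)

      union-simplex : P → Σ (List V) (IsSimplexOfDim _≺_ K (suc k))
      union-simplex (_ , τ , (_ , _ , _ , _ , τ-simplex , _)) = τ , τ-simplex

      union-cong : ∀ p q → proj₁ p ≡ proj₁ q → proj₁ (union-simplex p) ≡ proj₁ (union-simplex q)
      union-cong (_ , τ , (_ , _ , _ , τ-union , (sτ , _) , _)) (_ , τ′ , (_ , _ , _ , τ′-union , (sτ′ , _) , _)) refl =
        IsUnion-unique (increasing τ sτ) (increasing τ′ sτ′) τ-union τ′-union

      union-injective : ∀ p q → proj₁ (union-simplex p) ≡ proj₁ (union-simplex q) → proj₁ p ≡ proj₁ q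
      union-injective (_ , τ , p) (_ , .τ , q) refl with InPWith⇒canonical p | InPWith⇒canonical q
      ... | refl , refl | refl , refl = refl

      surjective : ∀ y → ∃ λ p → ∀ {q} → proj₁ q ≡ proj₁ p → proj₁ (union-simplex q) ≡ proj₁ y
      surjective (τ , τ-simplex) = canonical , λ {q} q≡ → union-cong q canonical q≡
        where
        canonical : P
        canonical = (take (suc k) τ , dropPenultimate τ) , τ , canonical-InPWith τ-simplex

    InPWith⇒commonMinFace : ∀ {m σ₀ σ₁ τ} → InPWith _≺_ K (suc m) σ₀ σ₁ τ →
      ∃ λ ρ → simplex ρ × Face _≺_ m ρ σ₀ × Face _≺_ m ρ σ₁
        × IsMinFace _≺_ m ρ τ × IsMinFace _≺_ m ρ σ₀ × IsMinFace _≺_ m ρ σ₁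
    InPWith⇒commonMinFace {m} {σ₀} {σ₁} {τ} p@((sσ₀ , lσ₀) , (sσ₁ , lσ₁) , _ , _ , (sτ , lτ) , _) =
      ρ , proj₁ (face-simplex sτ (proj₁ ρ-min-τ)) , proj₁ ρ-min-σ₀ , proj₁ ρ-min-σ₁ , ρ-min-τ , ρ-min-σ₀ , ρ-min-σ₁
      where
      ρ : List V
      ρ = take (suc m) τ

      ρ-min-τ : IsMinFace _≺_ m ρ τ
      ρ-min-τ = take-IsMinFace (increasing τ sτ) (≤-trans (n≤1+n (suc m)) (m≡1+n⇒n≤m lτ))

      open ≡-Reasoning

      ρ-min-σ₀ : IsMinFace _≺_ m ρ σ₀
      ρ-min-σ₀ = IsMinFace-take (increasing σ₀ sσ₀) (m≡1+n⇒n≤m lσ₀) (begin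
        take (suc m) σ₀                     ≡⟨ cong (take (suc m)) (proj₁ (InPWith⇒canonical p)) ⟩
        take (suc m) (take (suc (suc m)) τ) ≡⟨ take-take (suc m) (suc (suc m)) τ ⟩
        take (suc m ⊓ suc (suc m)) τ        ≡⟨ cong (λ n → take n τ) (m≤n⇒m⊓n≡m (n≤1+n (suc m))) ⟩
        ρ                                   ∎)

      ρ-min-σ₁ : IsMinFace _≺_ m ρ σ₁
      ρ-min-σ₁ = IsMinFace-take (increasing σ₁ sσ₁) (m≡1+n⇒n≤m lσ₁) (begin
        take (suc m) σ₁                  ≡⟨ cong (take (suc m)) (proj₂ (InPWith⇒canonical p)) ⟩
        take (suc m) (dropPenultimate τ) ≡⟨ take-dropPenultimate (suc m) τ lτ ⟩
        ρ                                ∎)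

theorem2p5 : {V : Set} (_≺_ : Rel V 0ℓ) → IsStrictTotalOrder _≡_ _≺_ →
    (K : SimplicialComplex _≺_) →
    ((k : ℕ) → 1 < k →
       Bijection (PSetoid _≺_ K k) (SimplicesSetoid _≺_ K (suc k)))
    ×
    ((k : ℕ) → 1 < k → (σ₀ σ₁ τ : List V) → InPWith _≺_ K k σ₀ σ₁ τ →
       ∃ λ ρ → SimplicialComplex.simplex K ρ
         × Face _≺_ (pred k) ρ σ₀ × Face _≺_ (pred k) ρ σ₁
         × IsMinFace _≺_ (pred k) ρ τ
         × IsMinFace _≺_ (pred k) ρ σ₀
         × IsMinFace _≺_ (pred k) ρ σ₁)
theorem2p5 _≺_ sto K =
  (λ k _ → P↔simplices sto K k) ,
  λ { (suc m) _ _ _ _ p → InPWith⇒commonMinFace sto K p }
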